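{- Let $q=2^k$ with $k\ge1$, let $n=4m+2$ with $m\ge 0$, let $\theta\in\mathrm{GF}(q^n)$ generate a self-dual normal basis of $\mathrm{GF}(q^n)$ over $\mathrm{GF}(q)$, and let $\varepsilon=Tr_{q^{2m+1}}(\theta^{q^{2m+1}+1})\in\mathrm{GF}(q)$. Then for all $t,s\in\mathrm{GF}(q)$, $F(n,t,s)=F^*(n,t,s+\varepsilon t^2)$.
   Context: For finite fields $\mathrm{GF}(Q^r)\supseteq\mathrm{GF}(Q)$, $Tr_{Q^r:Q}(x)=\sum_{i=0}^{r-1}x^{Q^i}$; $Tr_{q^{2m+1}}$ denotes the trace from $\mathrm{GF}(q^{2m+1})$ to $\mathrm{GF}(q)$. A normal basis $\{\theta,\dots,\theta^{q^{n-1}}\}$ is self-dual if $Tr_{q^n:q}(\theta^{q^i}\theta^{q^j})=[i=j]$. For $\beta\in\mathrm{GF}(q^n)$, $Tr(\beta)=\sum_{i=0}^{n-1}\beta^{q^i}$ and $St(\beta)=\sum_{0\le i<j<n}\beta^{q^i}\beta^{q^j}$; $F(n,t,s)$ is the number of $\beta\in\mathrm{GF}(q^n)$ with $Tr(\beta)=t$, $St(\beta)=s$. $F^*(n,t,s)$ is the number of $(a_0,\dots,a_{n-1})\in\mathrm{GF}(q)^n$ with $\sum_i a_i=t$ and $\sum_{i<j}a_ia_j=s$. -}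

module Defs where

open import Level using (0ℓ)
open import Algebra.Bundles using (CommutativeRing; Semiring)
import Algebra.Definitions.RawSemiring as RS
open import Data.Nat as ℕ using (ℕ; zero; suc)
open import Data.Fin using (Fin; toℕ)
open import Data.List using (List; []; _∷_; map; filter; length; cartesianProductWith; allFin)
open import Data.Vec using (Vec; []; _∷_)
open import Data.Product using (Σ; _×_; _,_)
open import Relation.Binary.PropositionalEquality using (_≡_)
open import Relation.Nullary using (¬_; Dec)
open import Relation.Nullary.Decidable using (_×-dec_)

record FiniteField : Set₁ where
  field
    commRing : CommutativeRing 0ℓ 0ℓ
  open CommutativeRing commRing public
  field
    1≉0      : ¬ (1# ≈ 0#)
    inverse  : ∀ x → ¬ (x ≈ 0#) → Σ Carrier λ y → x * y ≈ 1#
    _≟_      : ∀ x y → Dec (x ≈ y)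
    size     : ℕ
    enum     : Fin size → Carrier
    enum-inj : ∀ i j → enum i ≈ enum j → i ≡ j
    enum-sur : ∀ x → Σ (Fin size) λ i → enum i ≈ x
  open RS (Semiring.rawSemiring semiring) public using (_^_)

module FF (L : FiniteField) (q : ℕ) where
  open FiniteField L

  ∑< : ℕ → (ℕ → Carrier) → Carrier
  ∑< zero    f = 0#
  ∑< (suc n) f = ∑< n f + f n

  frob : ℕ → Carrier → Carrier
  frob i x = x ^ (q ℕ.^ i)

  Tr : ℕ → Carrier → Carrier
  Tr r x = ∑< r (λ i → frob i x)

  St : ℕ → Carrier → Carrier
  St n β = ∑< n (λ j → ∑< j (λ i → frob i β * frob j β))

  InGFq : Carrier → Set
  InGFq x = x ^ q ≈ x

  elements : List Carrier
  elements = map enum (allFin size)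

  gfq : List Carrier
  gfq = filter (λ x → (x ^ q) ≟ x) elements

  tuples : (n : ℕ) → List (Vec Carrier n)
  tuples zero    = [] ∷ []
  tuples (suc n) = cartesianProductWith _∷_ gfq (tuples n)

  e₁ : ∀ {n} → Vec Carrier n → Carrier
  e₁ []       = 0#
  e₁ (a ∷ as) = a + e₁ as

  e₂ : ∀ {n} → Vec Carrier n → Carrier
  e₂ []       = 0#
  e₂ (a ∷ as) = a * e₁ as + e₂ as

  Fcount : ℕ → Carrier → Carrier → ℕ
  Fcount n t s = length (filter (λ β → (Tr n β ≟ t) ×-dec (St n β ≟ s)) elements)

  F*count : ℕ → Carrier → Carrier → ℕ
  F*count n t s = length (filter (λ a → (e₁ a ≟ t) ×-dec (e₂ a ≟ s)) (tuples n))

  δ : ℕ → ℕ → Carrier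
  δ i j with i ℕ.≟ j
  ... | Relation.Nullary.yes _ = 1#
  ... | Relation.Nullary.no  _ = 0#

  -- {θ, θ^q, …, θ^(q^(n-1))} is a normal basis of L over GF(q):
  -- linearly independent over GF(q) (spanning follows from |L| = q^n).
  IsNormalBasis : ℕ → Carrier → Set
  IsNormalBasis n θ =
    (a : ℕ → Carrier) → (∀ i → i ℕ.< n → InGFq (a i)) →
    ∑< n (λ i → a i * frob i θ) ≈ 0# → ∀ i → i ℕ.< n → a i ≈ 0#

  IsSelfDualNormalBasis : ℕ → Carrier → Set
  IsSelfDualNormalBasis n θ =
    IsNormalBasis n θ ×
    (∀ i j → i ℕ.< n → j ℕ.< n → Tr n (frob i θ * frob j θ) ≈ δ i j)

module Submission where

-- Write θ[i] = θ^(qⁱ). Self-duality, Tr(θ[i] θ[j]) = δᵢⱼ, makes a ↦ Σ aᵢ θ[i] injective on GF(q)ⁿ,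
-- and it is onto because |GF(q)| ≥ q: every fibre of Tr is the zero set of a polynomial of degree
-- q^(n-1). Along this map Tr(Σ aᵢ θ[i]) = Σ aᵢ, since Tr(θ[i])² = Tr(θ[i]²) = 1. In characteristic
-- two St(x + y) = St x + St y + Tr x Tr y + Tr(xy) and St(ax) = a² St x for a ∈ GF(q), so
-- St(Σ aᵢ θ[i]) = Σ_{i<j} aᵢaⱼ + St(θ) (Σ aᵢ)². Finally St(θ) = ε: grouping the pairs i < j of
-- St(θ) by cyclic distance, the distances d and n − d together give Tr(θ θ[d]) = 0, which leaves
-- the pairs at distance n/2, and these add up to Tr_{q^(n/2)}(θ^(q^(n/2) + 1)).

open import Defs

open import Data.List using (List; []; _∷_; _++_; length; filter; map; concatMap; cartesianProductWith)
import Data.List.Properties as Listₚ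
open import Data.List.Relation.Unary.AllPairs using ([]; _∷_)
open import Data.List.Relation.Unary.Any using (here; there; any?)
open import Data.Nat as ℕ using (ℕ; zero; suc; _∸_; _<_; _≤_; z≤n; s≤s)
import Data.Nat.Properties as ℕₚ
open import Data.Nat.Tactic.RingSolver using (solve-∀)
open import Function using (_∘_)
open import Relation.Binary.Bundles using (Setoid)
open import Relation.Binary.Definitions using (Decidable)
open import Relation.Binary.PropositionalEquality as ≡ using (_≡_; _≢_)
open import Relation.Nullary using (¬_; Dec; yes; no; contradiction)

module UniqueLists {c ℓ} (S : Setoid c ℓ) where
  open Setoid S renaming (Carrier to A)
  open import Data.Product using (∃-syntax; _×_; _,_)
  open import Data.List.Relation.Unary.All using (All)
  open import Data.List.Membership.Setoid S using (_∈_)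
  open import Data.List.Membership.Setoid.Properties using (∈-∃++; ∈-resp-≈; ∉⇒All[≉]; All[≉]⇒∉)
  open import Data.List.Relation.Binary.Subset.Setoid S using (_⊆_)
  open import Data.List.Relation.Binary.Subset.Setoid.Properties using (∈-∷⁺ʳ)
  open import Data.List.Relation.Binary.Permutation.Setoid S as ↭ using (_↭_; ↭-refl; ↭-sym; ↭-trans)
  open import Data.List.Relation.Binary.Permutation.Setoid.Properties S using (∈-resp-↭; xs↭ys⇒|xs|≡|ys|; shift; Unique-resp-↭)
  open import Data.List.Relation.Unary.Unique.Setoid S using (Unique)

  private
    ∈⇒↭∷ : ∀ {x ys} → x ∈ ys → ∃[ y ] ∃[ ys′ ] x ≈ y × ys ↭ y ∷ ys′
    ∈⇒↭∷ x∈ys with ∈-∃++ S x∈ys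
    ... | as , bs , y , x≈y , ys≋ = y , as ++ bs , x≈y , ↭-trans (↭.refl ys≋) (shift refl as bs)

    ⊆-drop : ∀ {x xs y ys ys′} → All (λ z → ¬ x ≈ z) xs → x ≈ y → ys ↭ y ∷ ys′ →
             x ∷ xs ⊆ ys → xs ⊆ ys′
    ⊆-drop x∉xs x≈y ys↭ x∷xs⊆ys z∈xs with ∈-resp-↭ ys↭ (x∷xs⊆ys (there z∈xs))
    ... | here z≈y   = contradiction (∈-resp-≈ S (trans z≈y (sym x≈y)) z∈xs) (All[≉]⇒∉ S x∉xs)
    ... | there z∈ys′ = z∈ys′

  Unique-⊆⇒length≤ : ∀ {xs ys} → Unique xs → xs ⊆ ys → length xs ≤ length ys
  Unique-⊆⇒length≤ {[]} _ _ = z≤n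
  Unique-⊆⇒length≤ {x ∷ xs} (x∉xs ∷ xs!) x∷xs⊆ys with ∈⇒↭∷ (x∷xs⊆ys (here refl))
  ... | y , ys′ , x≈y , ys↭ =
    ℕₚ.≤-trans (s≤s (Unique-⊆⇒length≤ xs! (⊆-drop x∉xs x≈y ys↭ x∷xs⊆ys)))
               (ℕₚ.≤-reflexive (≡.sym (xs↭ys⇒|xs|≡|ys| ys↭)))

  Unique-⊆-⊇⇒↭ : ∀ {xs ys} → Unique xs → Unique ys → xs ⊆ ys → ys ⊆ xs → xs ↭ ys
  Unique-⊆-⊇⇒↭ {[]} {[]} _ _ _ _ = ↭-refl
  Unique-⊆-⊇⇒↭ {[]} {_ ∷ _} _ _ _ ys⊆[] with ys⊆[] (here refl)
  ... | ()
  Unique-⊆-⊇⇒↭ {x ∷ xs} (x∉xs ∷ xs!) ys! x∷xs⊆ys ys⊆x∷xs with ∈⇒↭∷ (x∷xs⊆ys (here refl))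
  ... | y , ys′ , x≈y , ys↭ with Unique-resp-↭ ys↭ ys!
  ... | y∉ys′ ∷ ys′! = ↭-trans (↭.prep x≈y xs↭ys′) (↭-sym ys↭)
    where
    xs↭ys′ : xs ↭ ys′
    xs↭ys′ = Unique-⊆-⊇⇒↭ xs! ys′! (⊆-drop x∉xs x≈y ys↭ x∷xs⊆ys)
               (⊆-drop y∉ys′ (sym x≈y) ↭-refl (ys⊆x∷xs ∘ ∈-resp-↭ (↭-sym ys↭)))

  module _ (_≟_ : Decidable _≈_) where

    Unique-⊆-length≥⇒⊇ : ∀ {xs ys} → Unique xs → xs ⊆ ys → length ys ≤ length xs → ys ⊆ xs
    Unique-⊆-length≥⇒⊇ {xs} xs! xs⊆ys |ys|≤|xs| {y} y∈ys with any? (y ≟_) xs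
    ... | yes y∈xs = y∈xs
    ... | no  y∉xs = contradiction
      (ℕₚ.≤-trans (Unique-⊆⇒length≤ (∉⇒All[≉] S y∉xs ∷ xs!) (∈-∷⁺ʳ S y∈ys xs⊆ys)) |ys|≤|xs|)
      (ℕₚ.<-irrefl ≡.refl)

length-concatMap≤ : ∀ {a b} {A : Set a} {B : Set b} {D} (f : A → List B) →
                    (∀ x → length (f x) ≤ D) → ∀ xs → length (concatMap f xs) ≤ length xs ℕ.* D
length-concatMap≤ f |f|≤D [] = z≤n
length-concatMap≤ f |f|≤D (x ∷ xs) = begin
  length (f x ++ concatMap f xs)               ≡⟨ Listₚ.length-++ (f x) ⟩
  length (f x) ℕ.+ length (concatMap f xs)    ≤⟨ ℕₚ.+-mono-≤ (|f|≤D x) (length-concatMap≤ f |f|≤D xs) ⟩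
  _ ∎
  where open ℕₚ.≤-Reasoning

length-cartesianProductWith : ∀ {a b c} {A : Set a} {B : Set b} {C : Set c} (f : A → B → C) xs ys →
                              length (cartesianProductWith f xs ys) ≡ length xs ℕ.* length ys
length-cartesianProductWith f []       ys = ≡.refl
length-cartesianProductWith f (x ∷ xs) ys = ≡.trans (Listₚ.length-++ (map (f x) ys))
  (≡.cong₂ ℕ._+_ (Listₚ.length-map (f x) ys) (length-cartesianProductWith f xs ys))

module FieldProperties (L : FiniteField) where
  open FiniteField L
  open import Algebra.Properties.Group +-group public using () renaming (∙-cancelˡ to +-cancelˡ)
  open import Algebra.Properties.Semiring.Mult semiring using (_×_; ×1-homo-*)
  open import Algebra.Properties.Semiring.Exp semiring using (^-congˡ)
  open import Data.Maybe using (nothing)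
  open import Algebra.Solver.Ring.NaturalCoefficients commutativeSemiring (λ _ _ → nothing)
    using (solve; _:=_; _:+_; _:*_)
  open import Data.Fin using (Fin)
  open import Data.List using (foldr; allFin)
  open import Data.List.Membership.Setoid setoid using (_∈_)
  open import Data.List.Membership.Setoid.Properties
    using (∈-resp-≈; ∈-map⁺; ∈-map⁻; ∈-filter⁺; ∈-filter⁻)
  import Data.List.Membership.Propositional.Properties as Membershipₚ
  open import Data.List.Relation.Binary.Subset.Setoid setoid using (_⊆_)
  open import Data.List.Relation.Binary.Permutation.Setoid setoid using (_↭_)
  open import Data.List.Relation.Binary.Permutation.Setoid.Properties setoid
    using (foldr-commMonoid; xs↭ys⇒|xs|≡|ys|)
  import Data.List.Relation.Unary.All as All
  import Data.List.Relation.Unary.All.Properties as Allₚ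
  open import Data.List.Relation.Unary.Unique.Setoid setoid using (Unique)
  import Data.List.Relation.Unary.Unique.Setoid.Properties as Unique
  import Data.List.Relation.Unary.Unique.Propositional.Properties as Uniqueₚ
  open import Data.Product using (_,_; proj₂)
  open import Function using (case_of_)
  open import Relation.Binary.Reasoning.Setoid setoid
  open import Relation.Nullary using (¬?)
  open UniqueLists setoid

  -- elements does not depend on the second argument of FF.
  open FF L 0 using (elements)

  *-cancelˡ : ∀ {a b c} → a ≉ 0# → a * b ≈ a * c → b ≈ c
  *-cancelˡ {a} {b} {c} a≉0 ab≈ac with inverse a a≉0
  ... | a⁻¹ , aa⁻¹≈1 = begin
    b                ≈⟨ *-identityˡ b ⟨
    1# * b           ≈⟨ *-congʳ (trans (sym aa⁻¹≈1) (*-comm a a⁻¹)) ⟩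
    (a⁻¹ * a) * b    ≈⟨ *-assoc a⁻¹ a b ⟩
    a⁻¹ * (a * b)    ≈⟨ *-congˡ ab≈ac ⟩
    a⁻¹ * (a * c)    ≈⟨ *-assoc a⁻¹ a c ⟨
    (a⁻¹ * a) * c    ≈⟨ *-congʳ (trans (*-comm a⁻¹ a) aa⁻¹≈1) ⟩
    1# * c           ≈⟨ *-identityˡ c ⟩
    c                ∎

  *-≉0 : ∀ {a b} → a ≉ 0# → b ≉ 0# → a * b ≉ 0#
  *-≉0 {a} a≉0 b≉0 ab≈0 = b≉0 (*-cancelˡ a≉0 (trans ab≈0 (sym (zeroʳ a))))

  ^-≉0 : ∀ {a} n → a ≉ 0# → a ^ n ≉ 0#
  ^-≉0 zero    _   = 1≉0
  ^-≉0 (suc n) a≉0 = *-≉0 a≉0 (^-≉0 n a≉0)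

  elements-unique : Unique elements
  elements-unique = Unique.map⁺ (≡.setoid (Fin size)) setoid (λ {i} {j} → enum-inj i j) (Uniqueₚ.allFin⁺ size)

  ∈-elements : ∀ x → x ∈ elements
  ∈-elements x with enum-sur x
  ... | i , enum-i≈x = ∈-resp-≈ setoid enum-i≈x
    (∈-map⁺ (≡.setoid (Fin size)) setoid (λ { ≡.refl → refl }) (Membershipₚ.∈-allFin i))

  length-elements : length elements ≡ size
  length-elements = ≡.trans (Listₚ.length-map enum (allFin size)) (Listₚ.length-tabulate (λ i → i))

  private
    ∑ₗ ∏ₗ : List Carrier → Carrier
    ∑ₗ = foldr _+_ 0#
    ∏ₗ = foldr _*_ 1#

    ∑ₗ-+ : ∀ c xs → ∑ₗ (map (c +_) xs) ≈ length xs × c + ∑ₗ xs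
    ∑ₗ-+ c [] = sym (+-identityˡ 0#)
    ∑ₗ-+ c (x ∷ xs) = begin
      (c + x) + ∑ₗ (map (c +_) xs)          ≈⟨ +-congˡ (∑ₗ-+ c xs) ⟩
      (c + x) + (length xs × c + ∑ₗ xs)     ≈⟨ solve 4 (λ c x n s → (c :+ x) :+ (n :+ s) := (c :+ n) :+ (x :+ s))
                                                 refl c x (length xs × c) (∑ₗ xs) ⟩
      (c + length xs × c) + (x + ∑ₗ xs)     ∎

    ∏ₗ-* : ∀ a xs → ∏ₗ (map (a *_) xs) ≈ a ^ length xs * ∏ₗ xs
    ∏ₗ-* a [] = sym (*-identityˡ 1#)
    ∏ₗ-* a (x ∷ xs) = begin
      (a * x) * ∏ₗ (map (a *_) xs)          ≈⟨ *-congˡ (∏ₗ-* a xs) ⟩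
      (a * x) * (a ^ length xs * ∏ₗ xs)     ≈⟨ solve 4 (λ a x p q → (a :* x) :* (p :* q) := (a :* p) :* (x :* q))
                                                 refl a x (a ^ length xs) (∏ₗ xs) ⟩
      (a * a ^ length xs) * (x * ∏ₗ xs)     ∎

  size×1≈0 : size × 1# ≈ 0#
  size×1≈0 = +-cancelˡ (∑ₗ elements) _ _ (begin
    ∑ₗ elements + size × 1#                          ≈⟨ +-comm _ _ ⟩
    size × 1# + ∑ₗ elements                          ≡⟨ ≡.cong (λ m → m × 1# + ∑ₗ elements) length-elements ⟨
    length elements × 1# + ∑ₗ elements               ≈⟨ ∑ₗ-+ 1# elements ⟨
    ∑ₗ (map (1# +_) elements)                        ≈⟨ foldr-commMonoid +-isCommutativeMonoid shifted↭elements ⟩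
    ∑ₗ elements                                      ≈⟨ +-identityʳ _ ⟨
    ∑ₗ elements + 0#                                 ∎)
    where
    shifted↭elements : map (1# +_) elements ↭ elements
    shifted↭elements = Unique-⊆-⊇⇒↭
      (Unique.map⁺ setoid setoid (+-cancelˡ 1# _ _) elements-unique) elements-unique
      (λ {z} _ → ∈-elements z)
      (λ {z} _ → ∈-resp-≈ setoid (trans (sym (+-assoc 1# (- 1#) z)) (trans (+-congʳ (-‿inverseʳ 1#)) (+-identityˡ z)))
                   (∈-map⁺ setoid setoid +-congˡ (∈-elements (- 1# + z))))

  ^-×1 : ∀ a b → (a ℕ.^ b) × 1# ≈ (a × 1#) ^ b
  ^-×1 a zero    = +-identityʳ 1#
  ^-×1 a (suc b) = trans (×1-homo-* a (a ℕ.^ b)) (*-congˡ (^-×1 a b))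

  characteristic-two : ∀ N → size ≡ 2 ℕ.^ N → 1# + 1# ≈ 0#
  characteristic-two N |L|≡2^N with (1# + 1#) ≟ 0#
  ... | yes 2≈0 = 2≈0
  ... | no  2≉0 = contradiction (begin
    (1# + 1#) ^ N         ≈⟨ ^-congˡ N (+-congˡ (+-identityʳ 1#)) ⟨
    (2 × 1#) ^ N          ≈⟨ ^-×1 2 N ⟨
    (2 ℕ.^ N) × 1#        ≡⟨ ≡.cong (_× 1#) |L|≡2^N ⟨
    size × 1#             ≈⟨ size×1≈0 ⟩
    0#                    ∎) (^-≉0 N 2≉0)

  private
    ≉0? : ∀ x → Dec (x ≉ 0#)
    ≉0? x = ¬? (x ≟ 0#)

    ≉0-resp : ∀ {x y} → x ≈ y → x ≉ 0# → y ≉ 0#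
    ≉0-resp x≈y x≉0 y≈0 = x≉0 (trans x≈y y≈0)

    units : List Carrier
    units = filter ≉0? elements

    ∈-units⁺ : ∀ {x} → x ≉ 0# → x ∈ units
    ∈-units⁺ {x} = ∈-filter⁺ setoid ≉0? ≉0-resp (∈-elements x)

    ∈-units⁻ : ∀ {x} → x ∈ units → x ≉ 0#
    ∈-units⁻ = proj₂ ∘ ∈-filter⁻ setoid ≉0? ≉0-resp {xs = elements}

    units-unique : Unique units
    units-unique = Unique.filter⁺ setoid ≉0? elements-unique

    size≡1+|units| : size ≡ suc (length units)
    size≡1+|units| = ≡.trans (≡.sym length-elements) (xs↭ys⇒|xs|≡|ys| elements↭0∷units)
      where
      elements↭0∷units : elements ↭ 0# ∷ units
      elements↭0∷units = Unique-⊆-⊇⇒↭ elements-unique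
        (All.map (_∘ sym) (Allₚ.all-filter ≉0? elements) ∷ units-unique)
        (λ {x} _ → case x ≟ 0# of λ { (yes x≈0) → here x≈0 ; (no x≉0) → there (∈-units⁺ x≉0) })
        (λ {x} _ → ∈-elements x)

    ∏ₗ-≉0 : ∀ xs → (∀ {x} → x ∈ xs → x ≉ 0#) → ∏ₗ xs ≉ 0#
    ∏ₗ-≉0 []       _    = 1≉0
    ∏ₗ-≉0 (x ∷ xs) xs≉0 = *-≉0 (xs≉0 (here refl)) (∏ₗ-≉0 xs (xs≉0 ∘ there))

    a*units↭units : ∀ {a} → a ≉ 0# → map (a *_) units ↭ units
    a*units↭units {a} a≉0 = Unique-⊆-⊇⇒↭
      (Unique.map⁺ setoid setoid (*-cancelˡ a≉0) units-unique) units-unique a*units⊆units units⊆a*units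
      where
      a*units⊆units : map (a *_) units ⊆ units
      a*units⊆units z∈ with ∈-map⁻ setoid setoid z∈
      ... | y , y∈ , z≈ay = ∈-units⁺ (≉0-resp (sym z≈ay) (*-≉0 a≉0 (∈-units⁻ y∈)))

      units⊆a*units : units ⊆ map (a *_) units
      units⊆a*units {z} z∈ with inverse a a≉0
      ... | a⁻¹ , aa⁻¹≈1 = ∈-resp-≈ setoid a[a⁻¹z]≈z
        (∈-map⁺ setoid setoid *-congˡ (∈-units⁺ (*-≉0 a⁻¹≉0 (∈-units⁻ z∈))))
        where
        a[a⁻¹z]≈z : a * (a⁻¹ * z) ≈ z
        a[a⁻¹z]≈z = trans (sym (*-assoc a a⁻¹ z)) (trans (*-congʳ aa⁻¹≈1) (*-identityˡ z))
        a⁻¹≉0 : a⁻¹ ≉ 0#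
        a⁻¹≉0 a⁻¹≈0 = 1≉0 (trans (sym aa⁻¹≈1) (trans (*-congˡ a⁻¹≈0) (zeroʳ a)))

    ^-|units|≈1 : ∀ {a} → a ≉ 0# → a ^ length units ≈ 1#
    ^-|units|≈1 {a} a≉0 = *-cancelˡ (∏ₗ-≉0 units ∈-units⁻) (begin
      ∏ₗ units * a ^ length units      ≈⟨ *-comm _ _ ⟩
      a ^ length units * ∏ₗ units      ≈⟨ ∏ₗ-* a units ⟨
      ∏ₗ (map (a *_) units)            ≈⟨ foldr-commMonoid *-isCommutativeMonoid (a*units↭units a≉0) ⟩
      ∏ₗ units                         ≈⟨ *-identityʳ _ ⟨
      ∏ₗ units * 1#                    ∎)

  x^size≈x : ∀ x → x ^ size ≈ x
  x^size≈x x = begin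
    x ^ size                ≡⟨ ≡.cong (x ^_) size≡1+|units| ⟩
    x * x ^ length units    ≈⟨ x*x^|units|≈x ⟩
    x                       ∎
    where
    x*x^|units|≈x : x * x ^ length units ≈ x
    x*x^|units|≈x with x ≟ 0#
    ... | yes x≈0 = trans (*-congʳ x≈0) (trans (zeroˡ _) (sym x≈0))
    ... | no  x≉0 = trans (*-congˡ (^-|units|≈1 x≉0)) (*-identityʳ x)

HasCharacteristicTwo : FiniteField → Set
HasCharacteristicTwo L = 1# + 1# ≈ 0#
  where
  open FiniteField L

module CharacteristicTwo (L : FiniteField) (1+1≈0 : HasCharacteristicTwo L) where
  open FiniteField L
  open FieldProperties L using (+-cancelˡ; *-cancelˡ; *-≉0)
  open import Algebra.Properties.Semiring.Exp semiring using (^-congˡ; ^-assocʳ)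
  open import Data.Maybe using (nothing)
  open import Algebra.Solver.Ring.NaturalCoefficients commutativeSemiring (λ _ _ → nothing)
    using (solve; _:=_; _:+_; _:*_; con)
  open import Data.List.Relation.Unary.All using (All; []; _∷_)
  open import Data.List.Relation.Unary.Unique.Setoid setoid using (Unique)
  open import Data.Product using (Σ; _×_; _,_)
  open import Relation.Binary.Reasoning.Setoid setoid

  x+x≈0 : ∀ x → x + x ≈ 0#
  x+x≈0 x = begin
    x + x              ≈⟨ solve 1 (λ x → x :+ x := (con 1 :+ con 1) :* x) refl x ⟩
    (1# + 1#) * x      ≈⟨ *-congʳ 1+1≈0 ⟩
    0# * x             ≈⟨ zeroˡ x ⟩
    0#                 ∎

  x+y≈z⇒x≈z+y : ∀ {x y z} → x + y ≈ z → x ≈ z + y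
  x+y≈z⇒x≈z+y {x} {y} {z} x+y≈z = begin
    x              ≈⟨ +-identityʳ x ⟨
    x + 0#         ≈⟨ +-congˡ (x+x≈0 y) ⟨
    x + (y + y)    ≈⟨ +-assoc x y y ⟨
    (x + y) + y    ≈⟨ +-congʳ x+y≈z ⟩
    z + y          ∎

  x²≈1⇒x≈1 : ∀ {x} → x * x ≈ 1# → x ≈ 1#
  x²≈1⇒x≈1 {x} x²≈1 with (x + 1#) ≟ 0#
  ... | yes x+1≈0 = trans (x+y≈z⇒x≈z+y x+1≈0) (+-identityˡ 1#)
  ... | no  x+1≉0 = contradiction (begin
    (x + 1#) * (x + 1#)        ≈⟨ solve 1 (λ x → (x :+ con 1) :* (x :+ con 1) := x :* x :+ con 1 :+ (x :+ x)) refl x ⟩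
    x * x + 1# + (x + x)       ≈⟨ +-cong (+-congʳ x²≈1) (x+x≈0 x) ⟩
    1# + 1# + 0#               ≈⟨ trans (+-identityʳ _) 1+1≈0 ⟩
    0#                         ∎) (*-≉0 x+1≉0 x+1≉0)

  Additive : ℕ → Set
  Additive e = ∀ x y → (x + y) ^ e ≈ x ^ e + y ^ e

  additive-2 : Additive 2
  additive-2 x y = begin
    (x + y) * ((x + y) * 1#)
      ≈⟨ solve 2 (λ x y → (x :+ y) :* ((x :+ y) :* con 1)
                          := (x :* (x :* con 1) :+ y :* (y :* con 1)) :+ (x :* y :+ x :* y)) refl x y ⟩
    (x ^ 2 + y ^ 2) + (x * y + x * y)    ≈⟨ +-congˡ (x+x≈0 (x * y)) ⟩
    (x ^ 2 + y ^ 2) + 0#                 ≈⟨ +-identityʳ _ ⟩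
    x ^ 2 + y ^ 2                        ∎

  additive-* : ∀ {a b} → Additive a → Additive b → Additive (a ℕ.* b)
  additive-* {a} {b} additive-a additive-b x y = begin
    (x + y) ^ (a ℕ.* b)              ≈⟨ ^-assocʳ (x + y) a b ⟨
    ((x + y) ^ a) ^ b                ≈⟨ ^-congˡ b (additive-a x y) ⟩
    (x ^ a + y ^ a) ^ b              ≈⟨ additive-b (x ^ a) (y ^ a) ⟩
    (x ^ a) ^ b + (y ^ a) ^ b        ≈⟨ +-cong (^-assocʳ x a b) (^-assocʳ y a b) ⟩
    x ^ (a ℕ.* b) + y ^ (a ℕ.* b)    ∎

  additive-^ : ∀ {a} → Additive a → ∀ j → Additive (a ℕ.^ j)
  additive-^ {a} additive-a zero    x y = distribʳ 1# x y
  additive-^ {a} additive-a (suc j) = additive-* {a} {a ℕ.^ j} additive-a (additive-^ additive-a j)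

  Additive⇒0^e≈0 : ∀ {e} → Additive e → 0# ^ e ≈ 0#
  Additive⇒0^e≈0 {e} additive-e = +-cancelˡ (0# ^ e) _ _ (begin
    0# ^ e + 0# ^ e     ≈⟨ additive-e 0# 0# ⟨
    (0# + 0#) ^ e       ≈⟨ ^-congˡ e (+-identityʳ 0#) ⟩
    0# ^ e              ≈⟨ +-identityʳ _ ⟨
    0# ^ e + 0#         ∎)

  -- The factor theorem, with x + r standing for x − r in characteristic two.
  Degree≤ : ℕ → (Carrier → Carrier) → Set
  Degree≤ zero    f = ∀ x y → f x ≈ f y
  Degree≤ (suc d) f = ∀ r → Σ (Carrier → Carrier) λ g → Degree≤ d g × (∀ x → f x ≈ (x + r) * g x + f r)

  Degree≤-const : ∀ d c → Degree≤ d (λ _ → c)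
  Degree≤-const zero    c _ _ = refl
  Degree≤-const (suc d) c _   = (λ _ → 0#) , Degree≤-const d 0# ,
                                 (λ x → sym (trans (+-congʳ (zeroʳ _)) (+-identityˡ c)))

  Degree≤-suc : ∀ d {f} → Degree≤ d f → Degree≤ (suc d) f
  Degree≤-suc zero    f-const r = (λ _ → 0#) , (λ _ _ → refl) ,
                                   (λ x → trans (f-const x r) (sym (trans (+-congʳ (zeroʳ _)) (+-identityˡ _))))
  Degree≤-suc (suc d) deg-f   r with deg-f r
  ... | g , deg-g , f≈ = g , Degree≤-suc d deg-g , f≈

  Degree≤-mono : ∀ {d d′ f} → d ≤ d′ → Degree≤ d f → Degree≤ d′ f
  Degree≤-mono {d′ = zero}   z≤n       deg-f = deg-f
  Degree≤-mono {d′ = suc d′} z≤n       deg-f = Degree≤-suc d′ (Degree≤-mono z≤n deg-f)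
  Degree≤-mono {d′ = suc d′} (s≤s d≤d′) deg-f r with deg-f r
  ... | g , deg-g , f≈ = g , Degree≤-mono d≤d′ deg-g , f≈

  Degree≤-+ : ∀ d {f g} → Degree≤ d f → Degree≤ d g → Degree≤ d (λ x → f x + g x)
  Degree≤-+ zero    f-const g-const x y = +-cong (f-const x y) (g-const x y)
  Degree≤-+ (suc d) {f} {g} deg-f deg-g r with deg-f r | deg-g r
  ... | f′ , deg-f′ , f≈ | g′ , deg-g′ , g≈ = (λ x → f′ x + g′ x) , Degree≤-+ d deg-f′ deg-g′ ,
    (λ x → trans (+-cong (f≈ x) (g≈ x))
      (solve 5 (λ a b c d e → (a :* b :+ d) :+ (a :* c :+ e) := a :* (b :+ c) :+ (d :+ e))
        refl (x + r) (f′ x) (g′ x) (f r) (g r)))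

  Degree≤-*ˡ : ∀ d c {f} → Degree≤ d f → Degree≤ d (λ x → c * f x)
  Degree≤-*ˡ zero    c f-const x y = *-congˡ (f-const x y)
  Degree≤-*ˡ (suc d) c {f} deg-f r with deg-f r
  ... | g , deg-g , f≈ = (λ x → c * g x) , Degree≤-*ˡ d c deg-g ,
    (λ x → trans (*-congˡ (f≈ x))
      (solve 4 (λ c a b d → c :* (a :* b :+ d) := a :* (c :* b) :+ c :* d) refl c (x + r) (g x) (f r)))

  Degree≤-x* : ∀ d {f} → Degree≤ d f → Degree≤ (suc d) (λ x → x * f x)
  Degree≤-x* d {f} deg-f r with Degree≤-suc d deg-f r
  ... | g , deg-g , f≈ = (λ x → f x + r * g x) , Degree≤-+ d deg-f (Degree≤-*ˡ d r deg-g) , x*f≈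
    where
    x*f≈ : ∀ x → x * f x ≈ (x + r) * (f x + r * g x) + r * f r
    x*f≈ x = sym (begin
      (x + r) * (f x + r * g x) + r * f r
        ≈⟨ +-congʳ (*-congˡ (+-congʳ (f≈ x))) ⟩
      (x + r) * (((x + r) * g x + f r) + r * g x) + r * f r
        ≈⟨ solve 4 (λ x r g c → (x :+ r) :* (((x :+ r) :* g :+ c) :+ r :* g) :+ r :* c
                                := x :* ((x :+ r) :* g :+ c) :+ (r :+ r) :* ((x :+ r) :* g :+ c))
             refl x r (g x) (f r) ⟩
      x * ((x + r) * g x + f r) + (r + r) * ((x + r) * g x + f r)
        ≈⟨ +-cong (*-congˡ (sym (f≈ x))) (trans (*-congʳ (x+x≈0 r)) (zeroˡ _)) ⟩
      x * f x + 0#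
        ≈⟨ +-identityʳ _ ⟩
      x * f x ∎)

  Degree≤-^ : ∀ e → Degree≤ e (_^ e)
  Degree≤-^ zero    _ _ = refl
  Degree≤-^ (suc e) = Degree≤-x* e (Degree≤-^ e)

  Degree≤⇒length-roots≤ : ∀ d {f} → Degree≤ d f → ∀ {x₀} → f x₀ ≉ 0# →
                          ∀ {xs} → Unique xs → All (λ x → f x ≈ 0#) xs → length xs ≤ d
  Degree≤⇒length-roots≤ d       deg-f f≉0 {[]} _ _ = z≤n
  Degree≤⇒length-roots≤ zero    f-const f≉0 {r ∷ _} _ (fr≈0 ∷ _) = contradiction (trans (f-const _ r) fr≈0) f≉0
  Degree≤⇒length-roots≤ (suc d) {f} deg-f {x₀} fx₀≉0 {r ∷ rs} (r∉rs ∷ rs!) (fr≈0 ∷ frs≈0) with deg-f r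
  ... | g , deg-g , f≈ = s≤s (Degree≤⇒length-roots≤ d deg-g gx₀≉0 rs! (roots-of-g r∉rs frs≈0))
    where
    gx₀≉0 : g x₀ ≉ 0#
    gx₀≉0 gx₀≈0 = fx₀≉0 (trans (f≈ x₀) (trans (+-cong (trans (*-congˡ gx₀≈0) (zeroʳ _)) fr≈0) (+-identityˡ 0#)))

    roots-of-g : ∀ {ys} → All (λ y → r ≉ y) ys → All (λ y → f y ≈ 0#) ys → All (λ y → g y ≈ 0#) ys
    roots-of-g []                  []              = []
    roots-of-g {y ∷ _} (r≉y ∷ r∉ys) (fy≈0 ∷ fys≈0) = *-cancelˡ y+r≉0 (begin
      (y + r) * g y          ≈⟨ +-identityʳ _ ⟨
      (y + r) * g y + 0#     ≈⟨ +-congˡ fr≈0 ⟨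
      (y + r) * g y + f r    ≈⟨ f≈ y ⟨
      f y                    ≈⟨ fy≈0 ⟩
      0#                     ≈⟨ zeroʳ _ ⟨
      (y + r) * 0#           ∎) ∷ roots-of-g r∉ys fys≈0
      where
      y+r≉0 : y + r ≉ 0#
      y+r≉0 y+r≈0 = r≉y (sym (trans (x+y≈z⇒x≈z+y y+r≈0) (+-identityˡ r)))

-- ∑< is declared inside FF L q, so these summation lemmas carry a q they never use.
module Sums (L : FiniteField) (q : ℕ) where
  open FiniteField L
  open FF L q
  open import Data.Maybe using (nothing)
  open import Algebra.Solver.Ring.NaturalCoefficients commutativeSemiring (λ _ _ → nothing)
    using (solve; _:=_; _:+_; _:*_; con)
  open import Relation.Binary.Reasoning.Setoid setoid
  open FieldProperties L using (+-cancelˡ)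

  ∑-cong< : ∀ n {f g : ℕ → Carrier} → (∀ i → i < n → f i ≈ g i) → ∑< n f ≈ ∑< n g
  ∑-cong< zero    f≈g = refl
  ∑-cong< (suc n) f≈g = +-cong (∑-cong< n (λ i i<n → f≈g i (ℕₚ.m<n⇒m<1+n i<n))) (f≈g n (ℕₚ.n<1+n n))

  ∑-cong : ∀ n {f g : ℕ → Carrier} → (∀ i → f i ≈ g i) → ∑< n f ≈ ∑< n g
  ∑-cong n f≈g = ∑-cong< n (λ i _ → f≈g i)

  ∑-≡ : ∀ {m n} {f : ℕ → Carrier} → m ≡ n → ∑< m f ≈ ∑< n f
  ∑-≡ ≡.refl = refl

  ∑-0# : ∀ n → ∑< n (λ _ → 0#) ≈ 0#
  ∑-0# zero    = refl
  ∑-0# (suc n) = trans (+-identityʳ _) (∑-0# n)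

  ∑-distrib-+ : ∀ n (f g : ℕ → Carrier) → ∑< n (λ i → f i + g i) ≈ ∑< n f + ∑< n g
  ∑-distrib-+ zero    f g = sym (+-identityʳ 0#)
  ∑-distrib-+ (suc n) f g = trans (+-congʳ (∑-distrib-+ n f g))
    (solve 4 (λ a b c d → (a :+ b) :+ (c :+ d) := (a :+ c) :+ (b :+ d)) refl (∑< n f) (∑< n g) (f n) (g n))

  *-distribˡ-∑ : ∀ n c (f : ℕ → Carrier) → c * ∑< n f ≈ ∑< n (λ i → c * f i)
  *-distribˡ-∑ zero    c f = zeroʳ c
  *-distribˡ-∑ (suc n) c f = trans (distribˡ c _ _) (+-congʳ (*-distribˡ-∑ n c f))

  *-distribʳ-∑ : ∀ n (f : ℕ → Carrier) c → ∑< n f * c ≈ ∑< n (λ i → f i * c)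
  *-distribʳ-∑ n f c = trans (*-comm _ _) (trans (*-distribˡ-∑ n c f) (∑-cong n (λ i → *-comm c (f i))))

  ∑-suc : ∀ n (f : ℕ → Carrier) → ∑< (suc n) f ≈ f 0 + ∑< n (f ∘ suc)
  ∑-suc zero    f = trans (+-identityˡ _) (sym (+-identityʳ _))
  ∑-suc (suc n) f = trans (+-congʳ (∑-suc n f)) (+-assoc _ _ _)

  ∑-split : ∀ a b (f : ℕ → Carrier) → ∑< (a ℕ.+ b) f ≈ ∑< a f + ∑< b (λ i → f (a ℕ.+ i))
  ∑-split a zero    f = trans (∑-≡ (ℕₚ.+-identityʳ a)) (sym (+-identityʳ _))
  ∑-split a (suc b) f = begin
    ∑< (a ℕ.+ suc b) f                                  ≈⟨ ∑-≡ (ℕₚ.+-suc a b) ⟩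
    ∑< (a ℕ.+ b) f + f (a ℕ.+ b)                        ≈⟨ +-congʳ (∑-split a b f) ⟩
    (∑< a f + ∑< b (λ i → f (a ℕ.+ i))) + f (a ℕ.+ b)   ≈⟨ +-assoc _ _ _ ⟩
    ∑< a f + ∑< (suc b) (λ i → f (a ℕ.+ i))             ∎

  ∑-reverse : ∀ n (f : ℕ → Carrier) → ∑< n (λ i → f (n ∸ suc i)) ≈ ∑< n f
  ∑-reverse zero    f = refl
  ∑-reverse (suc n) f = begin
    ∑< (suc n) (λ i → f (n ∸ i))             ≈⟨ ∑-suc n _ ⟩
    f n + ∑< n (λ i → f (n ∸ suc i))         ≈⟨ +-congˡ (∑-reverse n f) ⟩
    f n + ∑< n f                             ≈⟨ +-comm _ _ ⟩
    ∑< n f + f n                             ∎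

  ∑-rotate : ∀ n (f : ℕ → Carrier) → f n ≈ f 0 → ∑< n (f ∘ suc) ≈ ∑< n f
  ∑-rotate n f fn≈f0 = +-cancelˡ (f 0) _ _ (begin
    f 0 + ∑< n (f ∘ suc)       ≈⟨ ∑-suc n f ⟨
    ∑< n f + f n               ≈⟨ +-congˡ fn≈f0 ⟩
    ∑< n f + f 0               ≈⟨ +-comm _ _ ⟩
    f 0 + ∑< n f               ∎)

  pairSum : ℕ → (ℕ → Carrier) → Carrier
  pairSum m X = ∑< m (λ j → ∑< j (λ i → X i * X j))

  crossSum : ℕ → (ℕ → Carrier) → (ℕ → Carrier) → Carrier
  crossSum m X Y = ∑< m (λ j → ∑< j (λ i → X i * Y j + Y i * X j))

  pairSum-cong : ∀ m {X Y : ℕ → Carrier} → (∀ i → X i ≈ Y i) → pairSum m X ≈ pairSum m Y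
  pairSum-cong m X≈Y = ∑-cong m (λ j → ∑-cong j (λ i → *-cong (X≈Y i) (X≈Y j)))

  ∑-*-∑ : ∀ m (X Y : ℕ → Carrier) → ∑< m X * ∑< m Y ≈ crossSum m X Y + ∑< m (λ i → X i * Y i)
  ∑-*-∑ zero    X Y = trans (zeroˡ 0#) (sym (+-identityˡ 0#))
  ∑-*-∑ (suc m) X Y = begin
    (SX + X m) * (SY + Y m)
      ≈⟨ solve 4 (λ a b c d → (a :+ b) :* (c :+ d) := a :* c :+ (a :* d :+ c :* b) :+ b :* d) refl SX (X m) SY (Y m) ⟩
    SX * SY + (SX * Y m + SY * X m) + X m * Y m
      ≈⟨ +-congʳ (+-congʳ (∑-*-∑ m X Y)) ⟩
    (crossSum m X Y + D) + (SX * Y m + SY * X m) + X m * Y m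
      ≈⟨ solve 5 (λ a b c d e → (a :+ b) :+ (c :+ d) :+ e := (a :+ (c :+ d)) :+ (b :+ e))
           refl (crossSum m X Y) D (SX * Y m) (SY * X m) (X m * Y m) ⟩
    (crossSum m X Y + (SX * Y m + SY * X m)) + (D + X m * Y m)
      ≈⟨ +-congʳ (+-congˡ (+-cong (*-distribʳ-∑ m X (Y m)) (*-distribʳ-∑ m Y (X m)))) ⟩
    (crossSum m X Y + (∑< m (λ i → X i * Y m) + ∑< m (λ i → Y i * X m))) + (D + X m * Y m)
      ≈⟨ +-congʳ (+-congˡ (∑-distrib-+ m _ _)) ⟨
    crossSum (suc m) X Y + ∑< (suc m) (λ i → X i * Y i)   ∎
    where
    SX = ∑< m X
    SY = ∑< m Y
    D  = ∑< m (λ i → X i * Y i)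

  pairSum-+ : ∀ m (X Y : ℕ → Carrier) →
              pairSum m (λ i → X i + Y i) ≈ (pairSum m X + pairSum m Y) + crossSum m X Y
  pairSum-+ m X Y = begin
    pairSum m (λ i → X i + Y i)
      ≈⟨ ∑-cong m (λ j → ∑-cong j (λ i →
           solve 4 (λ a b c d → (a :+ b) :* (c :+ d) := (a :* c :+ b :* d) :+ (a :* d :+ b :* c))
             refl (X i) (Y i) (X j) (Y j))) ⟩
    ∑< m (λ j → ∑< j (λ i → (X i * X j + Y i * Y j) + (X i * Y j + Y i * X j)))
      ≈⟨ ∑-cong m (λ j → trans (∑-distrib-+ j _ _) (+-congʳ (∑-distrib-+ j _ _))) ⟩
    ∑< m (λ j → (∑< j (λ i → X i * X j) + ∑< j (λ i → Y i * Y j)) + ∑< j (λ i → X i * Y j + Y i * X j))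
      ≈⟨ trans (∑-distrib-+ m _ _) (+-congʳ (∑-distrib-+ m _ _)) ⟩
    (pairSum m X + pairSum m Y) + crossSum m X Y   ∎

  pairSum-*ˡ : ∀ m c (X : ℕ → Carrier) → pairSum m (λ i → c * X i) ≈ (c * c) * pairSum m X
  pairSum-*ˡ m c X = begin
    pairSum m (λ i → c * X i)
      ≈⟨ ∑-cong m (λ j → ∑-cong j (λ i →
           solve 3 (λ c a b → (c :* a) :* (c :* b) := (c :* c) :* (a :* b)) refl c (X i) (X j))) ⟩
    ∑< m (λ j → ∑< j (λ i → (c * c) * (X i * X j)))  ≈⟨ ∑-cong m (λ j → *-distribˡ-∑ j (c * c) _) ⟨
    ∑< m (λ j → (c * c) * ∑< j (λ i → X i * X j))    ≈⟨ *-distribˡ-∑ m (c * c) _ ⟨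
    (c * c) * pairSum m X                             ∎

  pairSum-suc : ∀ m (X : ℕ → Carrier) → pairSum (suc m) X ≈ X 0 * ∑< m (X ∘ suc) + pairSum m (X ∘ suc)
  pairSum-suc m X = begin
    pairSum (suc m) X                                               ≈⟨ ∑-suc m _ ⟩
    0# + ∑< m (λ j → ∑< (suc j) (λ i → X i * X (suc j)))            ≈⟨ +-identityˡ _ ⟩
    ∑< m (λ j → ∑< (suc j) (λ i → X i * X (suc j)))                 ≈⟨ ∑-cong m (λ j → ∑-suc j _) ⟩
    ∑< m (λ j → X 0 * X (suc j) + ∑< j (λ i → X (suc i) * X (suc j)))  ≈⟨ ∑-distrib-+ m _ _ ⟩
    ∑< m (λ j → X 0 * X (suc j)) + pairSum m (X ∘ suc)              ≈⟨ +-congʳ (*-distribˡ-∑ m (X 0) _) ⟨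
    X 0 * ∑< m (X ∘ suc) + pairSum m (X ∘ suc)                      ∎

  pairSum-rotate : ∀ m (X : ℕ → Carrier) → X m ≈ X 0 → pairSum m (X ∘ suc) ≈ pairSum m X
  pairSum-rotate m X Xm≈X0 = +-cancelˡ (X 0 * ∑< m (X ∘ suc)) _ _ (begin
    X 0 * ∑< m (X ∘ suc) + pairSum m (X ∘ suc)    ≈⟨ pairSum-suc m X ⟨
    pairSum (suc m) X                              ≈⟨ +-congˡ (*-distribʳ-∑ m X (X m)) ⟨
    pairSum m X + ∑< m X * X m                     ≈⟨ +-congˡ (*-cong (sym (∑-rotate m X Xm≈X0)) Xm≈X0) ⟩
    pairSum m X + ∑< m (X ∘ suc) * X 0             ≈⟨ +-comm _ _ ⟩
    ∑< m (X ∘ suc) * X 0 + pairSum m X             ≈⟨ +-congʳ (*-comm _ _) ⟩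
    X 0 * ∑< m (X ∘ suc) + pairSum m X             ∎)

  module _ (X : ℕ → Carrier) where

    pairsAt : ℕ → ℕ → Carrier
    pairsAt m e = ∑< (m ∸ e) (λ i → X i * X (i ℕ.+ e))

    correlation : ℕ → ℕ → Carrier
    correlation p e = ∑< p (λ i → X i * X (i ℕ.+ e))

    pairsAt-suc : ∀ m d → d < m → pairsAt (suc m) (suc d) ≈ pairsAt m (suc d) + X (m ∸ suc d) * X m
    pairsAt-suc m d d<m = begin
      ∑< (m ∸ d) f                          ≈⟨ ∑-≡ (ℕₚ.+-∸-assoc 1 d<m) ⟩
      ∑< (m ∸ suc d) f + f (m ∸ suc d)      ≈⟨ +-congˡ (*-congˡ (reflexive (≡.cong X (ℕₚ.m∸n+n≡m d<m)))) ⟩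
      pairsAt m (suc d) + X (m ∸ suc d) * X m   ∎
      where f = λ i → X i * X (i ℕ.+ suc d)

    pairSum≈∑pairsAt : ∀ m → pairSum m X ≈ ∑< m (λ d → pairsAt m (suc d))
    pairSum≈∑pairsAt zero    = refl
    pairSum≈∑pairsAt (suc m) = begin
      pairSum m X + ∑< m (λ i → X i * X m)
        ≈⟨ +-cong (pairSum≈∑pairsAt m) (sym (∑-reverse m (λ i → X i * X m))) ⟩
      ∑< m (λ d → pairsAt m (suc d)) + ∑< m (λ d → X (m ∸ suc d) * X m) ≈⟨ ∑-distrib-+ m _ _ ⟨
      ∑< m (λ d → pairsAt m (suc d) + X (m ∸ suc d) * X m)             ≈⟨ ∑-cong< m (pairsAt-suc m) ⟨
      ∑< m (λ d → pairsAt (suc m) (suc d))                              ≈⟨ +-identityʳ _ ⟨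
      ∑< m (λ d → pairsAt (suc m) (suc d)) + 0#                         ≈⟨ +-congˡ (∑-≡ (ℕₚ.n∸n≡0 m)) ⟨
      ∑< (suc m) (λ d → pairsAt (suc m) (suc d))                        ∎

    module _ {p} (periodic : ∀ i → X (i ℕ.+ p) ≈ X i) where

      correlation≈pairsAt+pairsAt : ∀ e → e ≤ p → correlation p e ≈ pairsAt p e + pairsAt p (p ∸ e)
      correlation≈pairsAt+pairsAt e e≤p = begin
        ∑< p f                                          ≈⟨ ∑-≡ (ℕₚ.m∸n+n≡m e≤p) ⟨
        ∑< ((p ∸ e) ℕ.+ e) f                            ≈⟨ ∑-split (p ∸ e) e f ⟩
        pairsAt p e + ∑< e (λ i → f (p ∸ e ℕ.+ i))      ≈⟨ +-congˡ (∑-cong e wrap) ⟩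
        pairsAt p e + ∑< e (λ i → X i * X (i ℕ.+ (p ∸ e)))  ≈⟨ +-congˡ (∑-≡ (ℕₚ.m∸[m∸n]≡n e≤p)) ⟨
        pairsAt p e + pairsAt p (p ∸ e)                 ∎
        where
        f = λ i → X i * X (i ℕ.+ e)
        wrap : ∀ i → f (p ∸ e ℕ.+ i) ≈ X i * X (i ℕ.+ (p ∸ e))
        wrap i = begin
          X (p ∸ e ℕ.+ i) * X (p ∸ e ℕ.+ i ℕ.+ e)   ≡⟨ ≡.cong (λ k → X (p ∸ e ℕ.+ i) * X k) index ⟩
          X (p ∸ e ℕ.+ i) * X (i ℕ.+ p)             ≈⟨ *-congˡ (periodic i) ⟩
          X (p ∸ e ℕ.+ i) * X i                     ≈⟨ *-comm _ _ ⟩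
          X i * X (p ∸ e ℕ.+ i)                     ≡⟨ ≡.cong (λ k → X i * X k) (ℕₚ.+-comm (p ∸ e) i) ⟩
          X i * X (i ℕ.+ (p ∸ e))                   ∎
          where
          index : p ∸ e ℕ.+ i ℕ.+ e ≡ i ℕ.+ p
          index = ≡.trans (a+i+e≡i+[a+e] (p ∸ e) i e) (≡.cong (i ℕ.+_) (ℕₚ.m∸n+n≡m e≤p))
            where
            a+i+e≡i+[a+e] : ∀ a i e → a ℕ.+ i ℕ.+ e ≡ i ℕ.+ (a ℕ.+ e)
            a+i+e≡i+[a+e] = solve-∀

      pairSum-even-period : ∀ h → p ≡ h ℕ.+ h → (∀ d → suc d < h → correlation p (suc d) ≈ 0#) →
                            pairSum p X ≈ ∑< h (λ i → X i * X (i ℕ.+ h))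
      pairSum-even-period zero     ≡.refl _              = refl
      pairSum-even-period (suc h′) ≡.refl correlation≈0 = begin
        pairSum p X                                                   ≈⟨ pairSum≈∑pairsAt p ⟩
        ∑< (h ℕ.+ h) F                                                ≈⟨ ∑-split h h F ⟩
        ∑< h F + ∑< h G                                               ≈⟨ +-congˡ (∑-reverse h G) ⟨
        ∑< h F + ∑< h (λ d → G (h ∸ suc d))                           ≈⟨ +-congˡ (∑-suc h′ _) ⟩
        ∑< h F + (G h′ + ∑< h′ (λ d → G (h′ ∸ suc d)))                ≈⟨ +-congˡ (+-cong G-last≈0 (∑-cong< h′ G≈pairsAt)) ⟩
        (∑< h′ F + F h′) + (0# + ∑< h′ (λ d → pairsAt p (p ∸ suc d)))
          ≈⟨ solve 3 (λ a b c → (a :+ b) :+ (con 0 :+ c) := (a :+ c) :+ b) refl _ _ _ ⟩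
        (∑< h′ F + ∑< h′ (λ d → pairsAt p (p ∸ suc d))) + F h′        ≈⟨ +-congʳ (∑-distrib-+ h′ _ _) ⟨
        ∑< h′ (λ d → F d + pairsAt p (p ∸ suc d)) + F h′              ≈⟨ +-congʳ (∑-cong< h′ complementary≈0) ⟩
        ∑< h′ (λ _ → 0#) + F h′                                       ≈⟨ +-congʳ (∑-0# h′) ⟩
        0# + F h′                                                     ≈⟨ +-identityˡ _ ⟩
        pairsAt p h                                                   ≈⟨ ∑-≡ (ℕₚ.m+n∸m≡n h h) ⟩
        ∑< h (λ i → X i * X (i ℕ.+ h))                                ∎
        where
        h = suc h′
        F G : ℕ → Carrier
        F d = pairsAt p (suc d)
        G d = F (h ℕ.+ d)

        G-last≈0 : G h′ ≈ 0#
        G-last≈0 = ∑-≡ (≡.trans (≡.cong (p ∸_) (≡.sym (ℕₚ.+-suc h h′))) (ℕₚ.n∸n≡0 p))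

        G≈pairsAt : ∀ d → d < h′ → G (h′ ∸ suc d) ≈ pairsAt p (p ∸ suc d)
        G≈pairsAt d d<h′ = reflexive (≡.cong (pairsAt p) (≡.sym (≡.trans
          (ℕₚ.+-∸-assoc h (s≤s (ℕₚ.<⇒≤ d<h′)))
          (≡.trans (≡.cong (h ℕ.+_) (ℕₚ.+-∸-assoc 1 d<h′)) (ℕₚ.+-suc h (h′ ∸ suc d))))))

        complementary≈0 : ∀ d → d < h′ → F d + pairsAt p (p ∸ suc d) ≈ 0#
        complementary≈0 d d<h′ = trans (sym (correlation≈pairsAt+pairsAt (suc d) suc-d≤p)) (correlation≈0 d (s≤s d<h′))
          where suc-d≤p = ℕₚ.≤-trans (s≤s (ℕₚ.<⇒≤ d<h′)) (ℕₚ.m≤m+n h h)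

module Frobenius (L : FiniteField) (1+1≈0 : HasCharacteristicTwo L) (k : ℕ) where
  open FiniteField L

  q : ℕ
  q = 2 ℕ.^ k

  open FF L q
  open CharacteristicTwo L 1+1≈0 using (Additive; additive-2; additive-^; Additive⇒0^e≈0)
  open import Algebra.Properties.Semiring.Exp semiring using (^-congˡ; ^-assocʳ)
  open import Algebra.Properties.CommutativeSemiring.Exp commutativeSemiring using (^-distrib-*)
  open import Relation.Binary.Reasoning.Setoid setoid

  additive-q : Additive q
  additive-q = additive-^ {2} additive-2 k

  additive-q^ : ∀ i → Additive (q ℕ.^ i)
  additive-q^ = additive-^ {q} additive-q

  ∑-^ : ∀ {e} → Additive e → ∀ n (f : ℕ → Carrier) → ∑< n f ^ e ≈ ∑< n (λ i → f i ^ e)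
  ∑-^ {e} additive-e zero    f = Additive⇒0^e≈0 {e} additive-e
  ∑-^ {e} additive-e (suc n) f = trans (additive-e _ _) (+-congʳ (∑-^ {e} additive-e n f))

  frob-cong : ∀ i {x y} → x ≈ y → frob i x ≈ frob i y
  frob-cong i = ^-congˡ (q ℕ.^ i)

  frob-+ : ∀ i x y → frob i (x + y) ≈ frob i x + frob i y
  frob-+ i = additive-q^ i

  frob-* : ∀ i x y → frob i (x * y) ≈ frob i x * frob i y
  frob-* i x y = ^-distrib-* x y (q ℕ.^ i)

  frob-0# : ∀ i → frob i 0# ≈ 0#
  frob-0# i = Additive⇒0^e≈0 {q ℕ.^ i} (additive-q^ i)

  frob-zero : ∀ x → frob 0 x ≈ x
  frob-zero x = *-identityʳ x

  frob-frob : ∀ i j x → frob i (frob j x) ≈ frob (j ℕ.+ i) x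
  frob-frob i j x = begin
    (x ^ (q ℕ.^ j)) ^ (q ℕ.^ i)    ≈⟨ ^-assocʳ x (q ℕ.^ j) (q ℕ.^ i) ⟩
    x ^ (q ℕ.^ j ℕ.* q ℕ.^ i)      ≡⟨ ≡.cong (x ^_) (ℕₚ.^-distribˡ-+-* q j i) ⟨
    x ^ (q ℕ.^ (j ℕ.+ i))          ∎

  frob-suc : ∀ i x → frob (suc i) x ≈ frob i x ^ q
  frob-suc i x = begin
    x ^ (q ℕ.* q ℕ.^ i)          ≡⟨ ≡.cong (x ^_) (ℕₚ.*-comm q (q ℕ.^ i)) ⟩
    x ^ (q ℕ.^ i ℕ.* q)          ≈⟨ ^-assocʳ x (q ℕ.^ i) q ⟨
    (x ^ (q ℕ.^ i)) ^ q          ∎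

  frob-suc-inner : ∀ i x → frob (suc i) x ≈ frob i (x ^ q)
  frob-suc-inner i x = sym (^-assocʳ x q (q ℕ.^ i))

  frob-InGFq : ∀ i {a} → InGFq a → frob i a ≈ a
  frob-InGFq zero    {a} _      = frob-zero a
  frob-InGFq (suc i) {a} a^q≈a = trans (frob-suc i a) (trans (^-congˡ q (frob-InGFq i a^q≈a)) a^q≈a)

  InGFq-resp : ∀ {a b} → a ≈ b → InGFq a → InGFq b
  InGFq-resp a≈b a^q≈a = trans (^-congˡ q (sym a≈b)) (trans a^q≈a a≈b)

  InGFq-0# : InGFq 0#
  InGFq-0# = Additive⇒0^e≈0 {q} additive-q

FrobeniusPeriodic : FiniteField → ℕ → ℕ → Set
FrobeniusPeriodic L q n = ∀ x → frob n x ≈ x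
  where
  open FiniteField L
  open FF L q

module TraceForms (L : FiniteField) (1+1≈0 : HasCharacteristicTwo L) (k n : ℕ)
                  (frob-n : FrobeniusPeriodic L (2 ℕ.^ k) n) where
  open FiniteField L
  open Frobenius L 1+1≈0 k
  open FF L q
  open Sums L q
  open CharacteristicTwo L 1+1≈0 using (x+y≈z⇒x≈z+y; additive-2)
  open import Relation.Binary.Reasoning.Setoid setoid

  private
    frob-n≈frob-0 : ∀ x → frob n x ≈ frob 0 x
    frob-n≈frob-0 x = trans (frob-n x) (sym (frob-zero x))

  Tr-cong : ∀ {x y} → x ≈ y → Tr n x ≈ Tr n y
  Tr-cong x≈y = ∑-cong n (λ i → frob-cong i x≈y)

  Tr-+ : ∀ x y → Tr n (x + y) ≈ Tr n x + Tr n y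
  Tr-+ x y = trans (∑-cong n (λ i → frob-+ i x y)) (∑-distrib-+ n _ _)

  Tr-0# : Tr n 0# ≈ 0#
  Tr-0# = trans (∑-cong n frob-0#) (∑-0# n)

  Tr-*ˡ : ∀ {a} x → InGFq a → Tr n (a * x) ≈ a * Tr n x
  Tr-*ˡ {a} x a∈GFq = trans (∑-cong n (λ i → trans (frob-* i a x) (*-congʳ (frob-InGFq i a∈GFq))))
                            (sym (*-distribˡ-∑ n a _))

  Tr-^q : ∀ x → Tr n (x ^ q) ≈ Tr n x
  Tr-^q x = trans (∑-cong n (λ i → sym (frob-suc-inner i x))) (∑-rotate n (λ i → frob i x) (frob-n≈frob-0 x))

  Tr-frob : ∀ i x → Tr n (frob i x) ≈ Tr n x
  Tr-frob zero    x = Tr-cong (frob-zero x)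
  Tr-frob (suc i) x = trans (Tr-cong (frob-suc i x)) (trans (Tr-^q (frob i x)) (Tr-frob i x))

  InGFq-Tr : ∀ x → InGFq (Tr n x)
  InGFq-Tr x = begin
    Tr n x ^ q                     ≈⟨ ∑-^ {q} additive-q n _ ⟩
    ∑< n (λ i → frob i x ^ q)      ≈⟨ ∑-cong n (λ i → frob-suc i x) ⟨
    ∑< n (λ i → frob (suc i) x)    ≈⟨ ∑-rotate n (λ i → frob i x) (frob-n≈frob-0 x) ⟩
    Tr n x                         ∎

  Tr-*-Tr : ∀ x → Tr n x * Tr n x ≈ Tr n (x * x)
  Tr-*-Tr x = begin
    Tr n x * Tr n x                       ≈⟨ *-congˡ (*-identityʳ _) ⟨
    Tr n x ^ 2                            ≈⟨ ∑-^ {2} additive-2 n _ ⟩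
    ∑< n (λ i → frob i x ^ 2)             ≈⟨ ∑-cong n (λ i → trans (*-congˡ (*-identityʳ _)) (sym (frob-* i x x))) ⟩
    Tr n (x * x)                          ∎

  St-cong : ∀ {x y} → x ≈ y → St n x ≈ St n y
  St-cong x≈y = pairSum-cong n (λ i → frob-cong i x≈y)

  -- The cross term is Tr x Tr y − Tr(xy); in characteristic two the − is a +.
  St-+ : ∀ x y → St n (x + y) ≈ (St n x + St n y) + (Tr n x * Tr n y + Tr n (x * y))
  St-+ x y = begin
    St n (x + y)                                       ≈⟨ pairSum-cong n (λ i → frob-+ i x y) ⟩
    pairSum n (λ i → X i + Y i)                        ≈⟨ pairSum-+ n X Y ⟩
    (St n x + St n y) + crossSum n X Y                 ≈⟨ +-congˡ (x+y≈z⇒x≈z+y (sym cross≈)) ⟩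
    (St n x + St n y) + (Tr n x * Tr n y + Tr n (x * y)) ∎
    where
    X Y : ℕ → Carrier
    X i = frob i x
    Y i = frob i y
    cross≈ : Tr n x * Tr n y ≈ crossSum n X Y + Tr n (x * y)
    cross≈ = trans (∑-*-∑ n X Y) (+-congˡ (∑-cong n (λ i → sym (frob-* i x y))))

  St-*ˡ : ∀ {a} x → InGFq a → St n (a * x) ≈ (a * a) * St n x
  St-*ˡ {a} x a∈GFq = trans (pairSum-cong n (λ i → trans (frob-* i a x) (*-congʳ (frob-InGFq i a∈GFq))))
                            (pairSum-*ˡ n a (λ i → frob i x))

  St-0# : St n 0# ≈ 0#
  St-0# = begin
    St n 0#              ≈⟨ St-cong (zeroˡ 0#) ⟨
    St n (0# * 0#)       ≈⟨ St-*ˡ 0# InGFq-0# ⟩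
    (0# * 0#) * St n 0#  ≈⟨ trans (*-congʳ (zeroˡ 0#)) (zeroˡ _) ⟩
    0#                   ∎

  St-^q : ∀ x → St n (x ^ q) ≈ St n x
  St-^q x = trans (pairSum-cong n (λ i → sym (frob-suc-inner i x))) (pairSum-rotate n (λ i → frob i x) (frob-n≈frob-0 x))

  St-frob : ∀ i x → St n (frob i x) ≈ St n x
  St-frob zero    x = St-cong (frob-zero x)
  St-frob (suc i) x = trans (St-cong (frob-suc i x)) (trans (St-^q (frob i x)) (St-frob i x))

SelfDual : (L : FiniteField) → ℕ → ℕ → FiniteField.Carrier L → Set
SelfDual L q n θ = ∀ i j → i < n → j < n → Tr n (frob i θ * frob j θ) ≈ δ i j
  where
  open FiniteField L
  open FF L q

module SelfDualBasis (L : FiniteField) (1+1≈0 : HasCharacteristicTwo L) (k n : ℕ)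
                     (frob-n : FrobeniusPeriodic L (2 ℕ.^ k) n)
                     (θ : FiniteField.Carrier L) (self-dual : SelfDual L (2 ℕ.^ k) n θ) where
  open FiniteField L
  open Frobenius L 1+1≈0 k
  open FF L q
  open Sums L q
  open CharacteristicTwo L 1+1≈0 using (x²≈1⇒x≈1; x+x≈0)
  open TraceForms L 1+1≈0 k n frob-n
  open FieldProperties L using (+-cancelˡ)
  open import Data.Maybe using (nothing)
  open import Algebra.Solver.Ring.NaturalCoefficients commutativeSemiring (λ _ _ → nothing)
    using (solve; _:=_; _:+_; _:*_)
  open import Algebra.Properties.Semiring.Exp semiring using (^-homo-*)
  open import Data.Vec using (Vec; []; _∷_)
  open import Data.Vec.Relation.Unary.All using (All; []; _∷_)
  open import Data.Vec.Relation.Binary.Equality.Setoid setoid using (_≋_; []; _∷_)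
  open import Relation.Binary.Reasoning.Setoid setoid

  θ[_] : ℕ → Carrier
  θ[ i ] = frob i θ

  δ-refl : ∀ i → δ i i ≈ 1#
  δ-refl i with i ℕ.≟ i
  ... | yes _  = refl
  ... | no i≢i = contradiction ≡.refl i≢i

  δ-≢ : ∀ {i j} → i ≢ j → δ i j ≈ 0#
  δ-≢ {i} {j} i≢j with i ℕ.≟ j
  ... | yes i≡j = contradiction i≡j i≢j
  ... | no  _   = refl

  Tr-θ[i]≈1 : ∀ {i} → i < n → Tr n θ[ i ] ≈ 1#
  Tr-θ[i]≈1 {i} i<n = x²≈1⇒x≈1 (trans (Tr-*-Tr θ[ i ]) (trans (self-dual i i i<n i<n) (δ-refl i)))

  θ-periodic : ∀ i → θ[ i ℕ.+ n ] ≈ θ[ i ]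
  θ-periodic i = trans (sym (frob-frob n i θ)) (frob-n θ[ i ])

  Tr-θ*θ[e] : ∀ e → Tr n (θ[ 0 ] * θ[ e ]) ≈ correlation θ[_] n e
  Tr-θ*θ[e] e = ∑-cong n (λ i → trans (frob-* i _ _)
    (*-cong (frob-frob i 0 θ) (trans (frob-frob i e θ) (reflexive (≡.cong θ[_] (ℕₚ.+-comm e i))))))

  θ-combination : ∀ {m} → ℕ → Vec Carrier m → Carrier
  θ-combination j []       = 0#
  θ-combination j (x ∷ xs) = x * θ[ j ] + θ-combination (suc j) xs

  private
    shift-bound : ∀ {j m} → j ℕ.+ suc m ≤ n → suc j ℕ.+ m ≤ n
    shift-bound {j} {m} = ℕₚ.≤-trans (ℕₚ.≤-reflexive (≡.sym (ℕₚ.+-suc j m)))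

    head-bound : ∀ {j m} → j ℕ.+ suc m ≤ n → j < n
    head-bound {j} {m} b = ℕₚ.≤-trans (s≤s (ℕₚ.m≤m+n j m)) (shift-bound b)

  Tr-x*θ[i] : ∀ {i x} → InGFq x → i < n → Tr n (x * θ[ i ]) ≈ x
  Tr-x*θ[i] x∈GFq i<n = trans (Tr-*ˡ _ x∈GFq) (trans (*-congˡ (Tr-θ[i]≈1 i<n)) (*-identityʳ _))

  Tr-θ[i]*x*θ[j] : ∀ {i j x} → InGFq x → i < n → j < n → Tr n (θ[ i ] * (x * θ[ j ])) ≈ x * δ i j
  Tr-θ[i]*x*θ[j] {i} {j} {x} x∈GFq i<n j<n = begin
    Tr n (θ[ i ] * (x * θ[ j ]))    ≈⟨ Tr-cong (x∙yz≈y∙xz θ[ i ] x θ[ j ]) ⟩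
    Tr n (x * (θ[ i ] * θ[ j ]))    ≈⟨ Tr-*ˡ _ x∈GFq ⟩
    x * Tr n (θ[ i ] * θ[ j ])      ≈⟨ *-congˡ (self-dual i j i<n j<n) ⟩
    x * δ i j                       ∎
    where open import Algebra.Properties.CommutativeSemigroup *-commutativeSemigroup using (x∙yz≈y∙xz)

  Tr-θ-combination : ∀ {m} j (xs : Vec Carrier m) → All InGFq xs → j ℕ.+ m ≤ n →
                     Tr n (θ-combination j xs) ≈ e₁ xs
  Tr-θ-combination j []       []               _ = Tr-0#
  Tr-θ-combination j (x ∷ xs) (x∈GFq ∷ xs∈GFq) b =
    trans (Tr-+ _ _) (+-cong (Tr-x*θ[i] x∈GFq (head-bound b)) (Tr-θ-combination (suc j) xs xs∈GFq (shift-bound b)))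

  Tr-θ[i]*θ-combination : ∀ {m} i j (xs : Vec Carrier m) → All InGFq xs → i < j → j ℕ.+ m ≤ n →
                          Tr n (θ[ i ] * θ-combination j xs) ≈ 0#
  Tr-θ[i]*θ-combination i j []       []               _   _ = trans (Tr-cong (zeroʳ _)) Tr-0#
  Tr-θ[i]*θ-combination i j (x ∷ xs) (x∈GFq ∷ xs∈GFq) i<j b = begin
    Tr n (θ[ i ] * (x * θ[ j ] + θ-combination (suc j) xs))
      ≈⟨ trans (Tr-cong (distribˡ _ _ _)) (Tr-+ _ _) ⟩
    Tr n (θ[ i ] * (x * θ[ j ])) + Tr n (θ[ i ] * θ-combination (suc j) xs)
      ≈⟨ +-cong (Tr-θ[i]*x*θ[j] x∈GFq (ℕₚ.<-trans i<j (head-bound b)) (head-bound b))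
                (Tr-θ[i]*θ-combination i (suc j) xs xs∈GFq (ℕₚ.m<n⇒m<1+n i<j) (shift-bound b)) ⟩
    x * δ i j + 0#
      ≈⟨ trans (+-identityʳ _) (trans (*-congˡ (δ-≢ (ℕₚ.<⇒≢ i<j))) (zeroʳ x)) ⟩
    0#  ∎

  Tr-θ[j]*θ-combination : ∀ {m} j x (xs : Vec Carrier m) → All InGFq (x ∷ xs) → j ℕ.+ suc m ≤ n →
                          Tr n (θ[ j ] * θ-combination j (x ∷ xs)) ≈ x
  Tr-θ[j]*θ-combination j x xs (x∈GFq ∷ xs∈GFq) b = begin
    Tr n (θ[ j ] * (x * θ[ j ] + θ-combination (suc j) xs))
      ≈⟨ trans (Tr-cong (distribˡ _ _ _)) (Tr-+ _ _) ⟩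
    Tr n (θ[ j ] * (x * θ[ j ])) + Tr n (θ[ j ] * θ-combination (suc j) xs)
      ≈⟨ +-cong (Tr-θ[i]*x*θ[j] x∈GFq (head-bound b) (head-bound b))
                (Tr-θ[i]*θ-combination j (suc j) xs xs∈GFq (ℕₚ.n<1+n j) (shift-bound b)) ⟩
    x * δ j j + 0#
      ≈⟨ trans (+-identityʳ _) (trans (*-congˡ (δ-refl j)) (*-identityʳ x)) ⟩
    x   ∎

  θ-combination-injective : ∀ {m} j (xs ys : Vec Carrier m) → All InGFq xs → All InGFq ys → j ℕ.+ m ≤ n →
                            θ-combination j xs ≈ θ-combination j ys → xs ≋ ys
  θ-combination-injective j []       []       _ _ _ _ = []
  θ-combination-injective j (x ∷ xs) (y ∷ ys) xs∈GFq@(_ ∷ xs′∈GFq) ys∈GFq@(_ ∷ ys′∈GFq) b eq =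
    x≈y ∷ θ-combination-injective (suc j) xs ys xs′∈GFq ys′∈GFq (shift-bound b)
            (+-cancelˡ _ _ _ (trans eq (+-congʳ (*-congʳ (sym x≈y)))))
    where
    x≈y : x ≈ y
    x≈y = begin
      x                                           ≈⟨ Tr-θ[j]*θ-combination j x xs xs∈GFq b ⟨
      Tr n (θ[ j ] * θ-combination j (x ∷ xs))    ≈⟨ Tr-cong (*-congˡ eq) ⟩
      Tr n (θ[ j ] * θ-combination j (y ∷ ys))    ≈⟨ Tr-θ[j]*θ-combination j y ys ys∈GFq b ⟩
      y                                           ∎

  module _ (h : ℕ) (n≡h+h : n ≡ h ℕ.+ h) where

    ε : Carrier
    ε = Tr h (θ ^ (q ℕ.^ h ℕ.+ 1))

    St-θ≈ε : St n θ ≈ ε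
    St-θ≈ε = begin
      pairSum n θ[_]                       ≈⟨ pairSum-even-period θ[_] θ-periodic h n≡h+h correlation≈0 ⟩
      ∑< h (λ i → θ[ i ] * θ[ i ℕ.+ h ])   ≈⟨ ∑-cong h conjugate ⟨
      ε                                    ∎
      where
      correlation≈0 : ∀ d → suc d < h → correlation θ[_] n (suc d) ≈ 0#
      correlation≈0 d suc-d<h = begin
        correlation θ[_] n (suc d)       ≈⟨ Tr-θ*θ[e] (suc d) ⟨
        Tr n (θ[ 0 ] * θ[ suc d ])       ≈⟨ self-dual 0 (suc d) (ℕₚ.≤-trans (s≤s z≤n) suc-d<n) suc-d<n ⟩
        δ 0 (suc d)                      ≈⟨ δ-≢ {0} {suc d} (λ ()) ⟩
        0#                               ∎
        where suc-d<n = ℕₚ.≤-trans suc-d<h (ℕₚ.≤-trans (ℕₚ.m≤m+n h h) (ℕₚ.≤-reflexive (≡.sym n≡h+h)))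

      conjugate : ∀ i → frob i (θ ^ (q ℕ.^ h ℕ.+ 1)) ≈ θ[ i ] * θ[ i ℕ.+ h ]
      conjugate i = begin
        frob i (θ ^ (q ℕ.^ h ℕ.+ 1))        ≈⟨ frob-cong i (^-homo-* θ (q ℕ.^ h) 1) ⟩
        frob i (θ[ h ] * θ[ 0 ])            ≈⟨ frob-* i _ _ ⟩
        frob i θ[ h ] * frob i θ[ 0 ]       ≈⟨ *-cong (frob-frob i h θ) (frob-frob i 0 θ) ⟩
        θ[ h ℕ.+ i ] * θ[ i ]               ≈⟨ *-comm _ _ ⟩
        θ[ i ] * θ[ h ℕ.+ i ]               ≡⟨ ≡.cong (λ j → θ[ i ] * θ[ j ]) (ℕₚ.+-comm h i) ⟩
        θ[ i ] * θ[ i ℕ.+ h ]               ∎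

    St-θ[i]≈ε : ∀ i → St n θ[ i ] ≈ ε
    St-θ[i]≈ε i = trans (St-frob i θ) St-θ≈ε

    St-θ-combination : ∀ {m} j (xs : Vec Carrier m) → All InGFq xs → j ℕ.+ m ≤ n →
                       St n (θ-combination j xs) ≈ e₂ xs + ε * (e₁ xs * e₁ xs)
    St-θ-combination j []       []               _ =
      trans St-0# (sym (trans (+-identityˡ _) (trans (*-congˡ (zeroˡ 0#)) (zeroʳ ε))))
    St-θ-combination {suc m} j (x ∷ xs) (x∈GFq ∷ xs∈GFq) b = begin
      St n (x * θ[ j ] + S)
        ≈⟨ St-+ _ _ ⟩
      (St n (x * θ[ j ]) + St n S) + (Tr n (x * θ[ j ]) * Tr n S + Tr n (x * θ[ j ] * S))
        ≈⟨ +-cong (+-cong (trans (St-*ˡ _ x∈GFq) (*-congˡ (St-θ[i]≈ε j)))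
                          (St-θ-combination (suc j) xs xs∈GFq (shift-bound b)))
                  (+-cong (*-cong (Tr-x*θ[i] x∈GFq (head-bound b)) (Tr-θ-combination (suc j) xs xs∈GFq (shift-bound b)))
                          cross≈0) ⟩
      ((x * x) * ε + (e₂ xs + ε * (a * a))) + (x * a + 0#)
        ≈⟨ +-identityʳ _ ⟨
      ((x * x) * ε + (e₂ xs + ε * (a * a))) + (x * a + 0#) + 0#
        ≈⟨ +-congˡ (trans (*-congˡ (x+x≈0 (x * a))) (zeroʳ ε)) ⟨
      ((x * x) * ε + (e₂ xs + ε * (a * a))) + (x * a + 0#) + ε * (x * a + x * a)
        ≈⟨ solve 5 (λ x e a b z → ((x :* x) :* e :+ (b :+ e :* (a :* a))) :+ (x :* a :+ z) :+ e :* (x :* a :+ x :* a)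
                                   := (x :* a :+ b) :+ e :* ((x :+ a) :* (x :+ a)) :+ z) refl x ε a (e₂ xs) 0# ⟩
      (x * a + e₂ xs) + ε * ((x + a) * (x + a)) + 0#
        ≈⟨ +-identityʳ _ ⟩
      (x * a + e₂ xs) + ε * ((x + a) * (x + a))  ∎
      where
      S = θ-combination (suc j) xs
      a = e₁ xs
      cross≈0 : Tr n (x * θ[ j ] * S) ≈ 0#
      cross≈0 = begin
        Tr n (x * θ[ j ] * S)        ≈⟨ Tr-cong (*-assoc x θ[ j ] S) ⟩
        Tr n (x * (θ[ j ] * S))      ≈⟨ Tr-*ˡ _ x∈GFq ⟩
        x * Tr n (θ[ j ] * S)        ≈⟨ *-congˡ (Tr-θ[i]*θ-combination j (suc j) xs xs∈GFq (ℕₚ.n<1+n j) (shift-bound b)) ⟩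
        x * 0#                       ≈⟨ zeroʳ x ⟩
        0#                           ∎

module Counting (L : FiniteField) (1+1≈0 : HasCharacteristicTwo L) (k n : ℕ)
                (|L|≡q^n : FiniteField.size L ≡ (2 ℕ.^ k) ℕ.^ n)
                (θ : FiniteField.Carrier L) (self-dual : SelfDual L (2 ℕ.^ k) n θ) where
  open FiniteField L
  open Frobenius L 1+1≈0 k using (q; InGFq-resp)
  open FF L q
  open FieldProperties L using (elements-unique; ∈-elements; length-elements; x^size≈x)
  open CharacteristicTwo L 1+1≈0
    using (x+x≈0; x+y≈z⇒x≈z+y; Degree≤; Degree≤-const; Degree≤-+; Degree≤-mono; Degree≤-^; Degree≤⇒length-roots≤)
  open import Data.List.Membership.Setoid setoid using (_∈_)
  open import Data.List.Membership.Setoid.Properties using (∈-filter⁺; ∈-filter⁻; ∈-concatMap⁺; ∈-map⁺; ∈-map⁻; ∈-resp-≈)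
  import Data.List.Membership.Propositional.Properties as Membershipₚ
  open import Data.List.Relation.Binary.Subset.Setoid setoid using (_⊆_)
  import Data.List.Relation.Unary.All as All
  import Data.List.Relation.Unary.All.Properties as Allₚ
  import Data.List.Relation.Unary.Any as Any
  import Data.List.Relation.Unary.Unique.Setoid as Uniqueₛ
  open Uniqueₛ setoid using (Unique)
  import Data.List.Relation.Unary.Unique.Setoid.Properties as Unique
  open import Data.Vec using (Vec; _∷_)
  import Data.Vec.Relation.Unary.All as Allᵥ
  open import Data.Vec.Relation.Binary.Equality.Setoid setoid using (≋-setoid; _∷_)
  open import Data.Product using (Σ; _×_; _,_; proj₂)
  open import Data.List.Relation.Binary.Permutation.Setoid.Properties setoid using (xs↭ys⇒|xs|≡|ys|)
  open import Relation.Nullary.Decidable using (_×-dec_)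
  open UniqueLists setoid using (Unique-⊆⇒length≤; Unique-⊆-⊇⇒↭; Unique-⊆-length≥⇒⊇)

  instance
    q≢0 : ℕ.NonZero q
    q≢0 = ℕₚ.m^n≢0 2 k

  frob-n : ∀ x → frob n x ≈ x
  frob-n x = trans (reflexive (≡.cong (x ^_) (≡.sym |L|≡q^n))) (x^size≈x x)

  open TraceForms L 1+1≈0 k n frob-n using (Tr-cong; Tr-0#; InGFq-Tr; St-cong)
  open SelfDualBasis L 1+1≈0 k n frob-n θ self-dual

  ∈-gfq⁺ : ∀ {x} → InGFq x → x ∈ gfq
  ∈-gfq⁺ {x} = ∈-filter⁺ setoid (λ x → (x ^ q) ≟ x) InGFq-resp (∈-elements x)

  Tr-degree : Degree≤ (q ℕ.^ ℕ.pred n) (Tr n)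
  Tr-degree = partial-trace-degree n ℕₚ.≤-refl
    where
    partial-trace-degree : ∀ j → j ≤ n → Degree≤ (q ℕ.^ ℕ.pred n) (λ x → ∑< j (λ i → frob i x))
    partial-trace-degree zero    _       = Degree≤-const _ 0#
    partial-trace-degree (suc j) suc-j≤n = Degree≤-+ _ (partial-trace-degree j (ℕₚ.<⇒≤ suc-j≤n))
      (Degree≤-mono (ℕₚ.^-monoʳ-≤ q (ℕₚ.suc[m]≤n⇒m≤pred[n] suc-j≤n)) (Degree≤-^ (q ℕ.^ j)))

  fibre : Carrier → List Carrier
  fibre c = filter (λ x → Tr n x ≟ c) elements

  Tr+c-nonroot : 0 < n → ∀ c → Σ Carrier λ x₀ → Tr n x₀ + c ≉ 0#
  Tr+c-nonroot 0<n c with c ≟ 0#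
  ... | yes c≈0 = θ[ 0 ] , λ Trθ+c≈0 → 1≉0 (trans (sym (trans (+-cong (Tr-θ[i]≈1 0<n) c≈0) (+-identityʳ 1#))) Trθ+c≈0)
  ... | no  c≉0 = 0# , λ Tr0+c≈0 → c≉0 (trans (sym (trans (+-congʳ Tr-0#) (+-identityˡ c))) Tr0+c≈0)

  length-fibre≤ : 0 < n → ∀ c → length (fibre c) ≤ q ℕ.^ ℕ.pred n
  length-fibre≤ 0<n c = Degree≤⇒length-roots≤ _ (Degree≤-+ _ Tr-degree (Degree≤-const _ c))
    (proj₂ (Tr+c-nonroot 0<n c))
    (Unique.filter⁺ setoid (λ x → Tr n x ≟ c) elements-unique)
    (All.map (λ Trx≈c → trans (+-congʳ Trx≈c) (x+x≈0 c)) (Allₚ.all-filter (λ x → Tr n x ≟ c) elements))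

  q≤|GF[q]| : 0 < n → q ≤ length gfq
  q≤|GF[q]| 0<n = ℕₚ.*-cancelʳ-≤ q (length gfq) (q ℕ.^ ℕ.pred n) {{ℕₚ.m^n≢0 q (ℕ.pred n)}} (begin
    q ℕ.* q ℕ.^ ℕ.pred n                ≡⟨ ≡.cong (q ℕ.^_) (ℕₚ.suc-pred n {{ℕ.>-nonZero 0<n}}) ⟩
    q ℕ.^ n                              ≡⟨ ≡.trans (≡.sym |L|≡q^n) (≡.sym length-elements) ⟩
    length elements                      ≤⟨ Unique-⊆⇒length≤ elements-unique elements⊆fibres ⟩
    length (concatMap fibre gfq)         ≤⟨ length-concatMap≤ fibre (length-fibre≤ 0<n) gfq ⟩
    length gfq ℕ.* q ℕ.^ ℕ.pred n       ∎)
    where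
    open ℕₚ.≤-Reasoning
    elements⊆fibres : elements ⊆ concatMap fibre gfq
    elements⊆fibres {x} _ = ∈-concatMap⁺ setoid setoid {xs = gfq} (Any.map x∈fibre (∈-gfq⁺ (InGFq-Tr x)))
      where
      x∈fibre : ∀ {c} → Tr n x ≈ c → x ∈ fibre c
      x∈fibre {c} = ∈-filter⁺ setoid (λ x → Tr n x ≟ c) (λ x≈y Trx≈c → trans (Tr-cong (sym x≈y)) Trx≈c) (∈-elements x)

  gfq-unique : Unique gfq
  gfq-unique = Unique.filter⁺ setoid (λ x → (x ^ q) ≟ x) elements-unique

  tuples-unique : ∀ j → Uniqueₛ.Unique (≋-setoid j) (tuples j)
  tuples-unique zero    = All.[] ∷ []
  tuples-unique (suc j) = Unique.cartesianProductWith⁺ setoid (≋-setoid j) (≋-setoid (suc j)) _∷_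
    (λ { (x≈y ∷ xs≋ys) → x≈y , xs≋ys }) gfq-unique (tuples-unique j)

  tuples-InGFq : ∀ j → All.All (Allᵥ.All InGFq) (tuples j)
  tuples-InGFq zero    = Allᵥ.[] All.∷ All.[]
  tuples-InGFq (suc j) = Allₚ.cartesianProductWith⁺ (≡.setoid _) (≡.setoid _) _∷_ gfq (tuples j)
    (λ x∈gfq v∈tuples → proj₂ (Membershipₚ.∈-filter⁻ (λ x → (x ^ q) ≟ x) {xs = elements} x∈gfq)
                        Allᵥ.∷ All.lookup (tuples-InGFq j) v∈tuples)

  length-tuples : ∀ j → length (tuples j) ≡ length gfq ℕ.^ j
  length-tuples zero    = ≡.refl
  length-tuples (suc j) = ≡.trans (length-cartesianProductWith _∷_ gfq (tuples j)) (≡.cong (length gfq ℕ.*_) (length-tuples j))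

  combinations-unique : ∀ {vs : List (Vec Carrier n)} → Uniqueₛ.Unique (≋-setoid n) vs →
                        All.All (Allᵥ.All InGFq) vs → Unique (map (θ-combination 0) vs)
  combinations-unique []           All.[]             = []
  combinations-unique (v∉vs ∷ vs!) (v∈GFq All.∷ vs∈GFq) =
    Allₚ.map⁺ (All.zipWith (λ (v≉w , w∈GFq) fv≈fw → v≉w (θ-combination-injective 0 _ _ v∈GFq w∈GFq ℕₚ.≤-refl fv≈fw))
                           (v∉vs , vs∈GFq))
    ∷ combinations-unique vs! vs∈GFq

  θ-combination-onto : 0 < n → elements ⊆ map (θ-combination 0) (tuples n)
  θ-combination-onto 0<n = Unique-⊆-length≥⇒⊇ _≟_
    (combinations-unique (tuples-unique n) (tuples-InGFq n)) (λ {z} _ → ∈-elements z) (begin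
      length elements                              ≡⟨ ≡.trans length-elements |L|≡q^n ⟩
      q ℕ.^ n                                      ≤⟨ ℕₚ.^-monoˡ-≤ n (q≤|GF[q]| 0<n) ⟩
      length gfq ℕ.^ n                             ≡⟨ ≡.trans (≡.sym (length-tuples n)) (≡.sym (Listₚ.length-map _ (tuples n))) ⟩
      length (map (θ-combination 0) (tuples n))    ∎)
    where open ℕₚ.≤-Reasoning

  module _ (h : ℕ) (n≡h+h : n ≡ h ℕ.+ h) (0<n : 0 < n) (t s : Carrier) where
    open import Relation.Binary.Reasoning.Setoid setoid

    private
      s′ : Carrier
      s′ = s + ε h n≡h+h * (t * t)

      IsTrSt : Carrier → Set
      IsTrSt β = Tr n β ≈ t × St n β ≈ s

      IsTrSt? : ∀ β → Dec (IsTrSt β)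
      IsTrSt? β = (Tr n β ≟ t) ×-dec (St n β ≟ s)

      IsE₁E₂ : Vec Carrier n → Set
      IsE₁E₂ a = e₁ a ≈ t × e₂ a ≈ s′

      IsE₁E₂? : ∀ a → Dec (IsE₁E₂ a)
      IsE₁E₂? a = (e₁ a ≟ t) ×-dec (e₂ a ≟ s′)

      f : Vec Carrier n → Carrier
      f = θ-combination 0

      IsTrSt-resp : ∀ {x y} → x ≈ y → IsTrSt x → IsTrSt y
      IsTrSt-resp x≈y (Trx≈t , Stx≈s) = trans (Tr-cong (sym x≈y)) Trx≈t , trans (St-cong (sym x≈y)) Stx≈s

      St-f : ∀ a → Allᵥ.All InGFq a → St n (f a) ≈ e₂ a + ε h n≡h+h * (e₁ a * e₁ a)
      St-f a a∈GFq = St-θ-combination h n≡h+h 0 a a∈GFq ℕₚ.≤-refl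

      IsE₁E₂⇒IsTrSt : ∀ a → Allᵥ.All InGFq a → IsE₁E₂ a → IsTrSt (f a)
      IsE₁E₂⇒IsTrSt a a∈GFq (e₁≈t , e₂≈s′) = trans (Tr-θ-combination 0 a a∈GFq ℕₚ.≤-refl) e₁≈t , (begin
        St n (f a)                                ≈⟨ St-f a a∈GFq ⟩
        e₂ a + ε h n≡h+h * (e₁ a * e₁ a)          ≈⟨ +-cong e₂≈s′ (*-congˡ (*-cong e₁≈t e₁≈t)) ⟩
        s′ + ε h n≡h+h * (t * t)                  ≈⟨ x+y≈z⇒x≈z+y refl ⟨
        s                                         ∎)

      IsTrSt⇒IsE₁E₂ : ∀ a → Allᵥ.All InGFq a → IsTrSt (f a) → IsE₁E₂ a
      IsTrSt⇒IsE₁E₂ a a∈GFq (Tr≈t , St≈s) = e₁≈t , (begin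
        e₂ a                                      ≈⟨ x+y≈z⇒x≈z+y (trans (sym (St-f a a∈GFq)) St≈s) ⟩
        s + ε h n≡h+h * (e₁ a * e₁ a)             ≈⟨ +-congˡ (*-congˡ (*-cong e₁≈t e₁≈t)) ⟩
        s′                                        ∎)
        where e₁≈t = trans (sym (Tr-θ-combination 0 a a∈GFq ℕₚ.≤-refl)) Tr≈t

    Fcount≡F*count : Fcount n t s ≡ F*count n t s′
    Fcount≡F*count = ≡.trans (xs↭ys⇒|xs|≡|ys| (Unique-⊆-⊇⇒↭ A-unique B-unique A⊆B B⊆A))
                             (Listₚ.length-map f (filter IsE₁E₂? (tuples n)))
      where
      A = filter IsTrSt? elements
      B = map f (filter IsE₁E₂? (tuples n))

      A-unique : Unique A
      A-unique = Unique.filter⁺ setoid IsTrSt? elements-unique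

      B-unique : Unique B
      B-unique = combinations-unique (Unique.filter⁺ (≋-setoid n) IsE₁E₂? (tuples-unique n))
                                     (Allₚ.filter⁺ IsE₁E₂? (tuples-InGFq n))

      B⊆A : B ⊆ A
      B⊆A {z} z∈B with ∈-map⁻ (≡.setoid _) setoid z∈B
      ... | a , a∈ , z≈fa with Membershipₚ.∈-filter⁻ IsE₁E₂? {xs = tuples n} a∈
      ... | a∈tuples , a-ok = ∈-filter⁺ setoid IsTrSt? IsTrSt-resp (∈-elements z)
        (IsTrSt-resp (sym z≈fa) (IsE₁E₂⇒IsTrSt a (All.lookup (tuples-InGFq n) a∈tuples) a-ok))

      A⊆B : A ⊆ B
      A⊆B {z} z∈A with ∈-filter⁻ setoid IsTrSt? IsTrSt-resp {xs = elements} z∈A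
      ... | _ , z-ok with ∈-map⁻ (≡.setoid _) setoid (θ-combination-onto 0<n (∈-elements z))
      ... | a , a∈tuples , z≈fa = ∈-resp-≈ setoid (sym z≈fa) (∈-map⁺ (≡.setoid _) setoid (λ { ≡.refl → refl })
        (Membershipₚ.∈-filter⁺ IsE₁E₂? a∈tuples
          (IsTrSt⇒IsE₁E₂ a (All.lookup (tuples-InGFq n) a∈tuples) (IsTrSt-resp z≈fa z-ok))))

open import Data.Nat using (_+_; _*_; _^_; _≥_)
open import Data.Product using (_,_)

corollary3 : (k : ℕ) → k ≥ 1 → (m : ℕ) → (L : FiniteField) →
    FiniteField.size L ≡ (2 ^ k) ^ (4 * m + 2) →
    (θ : FiniteField.Carrier L) →
    FF.IsSelfDualNormalBasis L (2 ^ k) (4 * m + 2) θ →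
    (t s : FiniteField.Carrier L) →
    FF.InGFq L (2 ^ k) t → FF.InGFq L (2 ^ k) s →
    FF.Fcount L (2 ^ k) (4 * m + 2) t s
      ≡ FF.F*count L (2 ^ k) (4 * m + 2) t
          (FiniteField._+_ L s
            (FiniteField._*_ L
              (FF.Tr L (2 ^ k) (2 * m + 1)
                (FiniteField._^_ L θ ((2 ^ k) ^ (2 * m + 1) + 1)))
              (FiniteField._*_ L t t)))
corollary3 k _ m L |L|≡q^n θ (_ , self-dual) t s _ _ =
  Counting.Fcount≡F*count L 1+1≈0 k (4 * m + 2) |L|≡q^n θ self-dual (2 * m + 1) n≡h+h 0<n t s
  where
  1+1≈0 : HasCharacteristicTwo L
  1+1≈0 = FieldProperties.characteristic-two L (k * (4 * m + 2)) (≡.trans |L|≡q^n (ℕₚ.^-*-assoc 2 k (4 * m + 2)))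

  4m+2≡[2m+1]+[2m+1] : ∀ m → 4 * m + 2 ≡ (2 * m + 1) + (2 * m + 1)
  4m+2≡[2m+1]+[2m+1] = solve-∀

  n≡h+h : 4 * m + 2 ≡ (2 * m + 1) + (2 * m + 1)
  n≡h+h = 4m+2≡[2m+1]+[2m+1] m

  0<n : 0 < 4 * m + 2
  0<n = ℕₚ.≤-trans (s≤s z≤n) (ℕₚ.m≤n+m 2 (4 * m))
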